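{- Let $G$ be a graph of order $n$ containing a cycle, with girth $g(G)\ge 6$. Then $PC(G)<n-2$.
   Context: The girth $g(G)$ of a graph with a cycle is the length of a shortest cycle. A paired dominating set of $G$ is a dominating set $S$ such that $G[S]$ has a perfect matching. Two disjoint sets form a paired coalition if neither is a paired dominating set but their union is. A $pc$-partition of $G$ is a partition of $V(G)$ into nonempty sets, none a paired dominating set, each forming a paired coalition with some other set of the partition. $PC(G)$ is the maximum number of sets in a $pc$-partition ($0$ if none exists). -}

module Defs where

open import Data.Nat using (ℕ; zero; suc; _≤_; _<_; _∸_)
open import Data.Fin using (Fin; toℕ)
open import Data.Product using (Σ; ∃; _×_; _,_)
open import Data.Sum using (_⊎_)
open import Relation.Nullary using (¬_)
open import Relation.Binary.PropositionalEquality using (_≡_; _≢_)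
open import Function.Definitions using (Injective; Surjective)

record Graph (n : ℕ) : Set₁ where
  field
    Adj    : Fin n → Fin n → Set
    sym    : ∀ {u v} → Adj u v → Adj v u
    irrefl : ∀ {v} → ¬ Adj v v
open Graph public

module _ {n : ℕ} (G : Graph n) where

  IsCycle : (k : ℕ) → (Fin k → Fin n) → Set
  IsCycle k c =
    (3 ≤ k) × Injective _≡_ _≡_ c
    × (∀ i j → toℕ j ≡ suc (toℕ i) → Adj G (c i) (c j))
    × (∀ i j → toℕ i ≡ 0 → suc (toℕ j) ≡ k → Adj G (c j) (c i))

  HasCycle : Set
  HasCycle = Σ ℕ λ k → Σ (Fin k → Fin n) λ c → IsCycle k c

  GirthAtLeast : ℕ → Set
  GirthAtLeast m = ∀ k (c : Fin k → Fin n) → IsCycle k c → m ≤ k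

  Dominating : (Fin n → Set) → Set
  Dominating S = ∀ v → S v ⊎ Σ (Fin n) λ u → S u × Adj G v u

  -- G[S] has a perfect matching: a partner function pairing each vertex
  -- of S with an adjacent vertex of S, pairs being mutual
  -- (so the edges {v, m v}, v ∈ S, are disjoint and cover S).
  HasPerfectMatching : (Fin n → Set) → Set
  HasPerfectMatching S = Σ (Fin n → Fin n) λ m →
    ∀ v → S v → S (m v) × Adj G v (m v) × m (m v) ≡ v

  PairedDominating : (Fin n → Set) → Set
  PairedDominating S = Dominating S × HasPerfectMatching S

  -- A pc-partition into k sets: p v is the index of the part containing v.
  IsPCPartition : (k : ℕ) → (Fin n → Fin k) → Set
  IsPCPartition k p =
    Surjective _≡_ _≡_ p
    × (∀ i → ¬ PairedDominating (λ v → p v ≡ i))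
    × (∀ i → Σ (Fin k) λ j → i ≢ j
         × ¬ PairedDominating (λ v → p v ≡ i)
         × ¬ PairedDominating (λ v → p v ≡ j)
         × PairedDominating (λ v → p v ≡ i ⊎ p v ≡ j))

  HasPCPartition : ℕ → Set
  HasPCPartition k = Σ (Fin n → Fin k) λ p → IsPCPartition k p

  -- IsPC m : m = PC(G), the maximum number of sets in a pc-partition,
  -- or 0 if no pc-partition exists.
  IsPC : ℕ → Set
  IsPC m =
    (m ≡ 0 × (∀ k → ¬ HasPCPartition k))
    ⊎ (HasPCPartition m × (∀ k → HasPCPartition k → k ≤ m))

{-# OPTIONS --safe #-}
module Submission where

-- Fix a pc-partition with k ≥ n − 2 parts and a representative in each part: at most two vertices
-- are not representatives, so all parts but at most two are singletons.  Without 3- and 4-cycles,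
-- and with a path on five vertices, no edge dominates G, so every paired dominating set has at
-- least four vertices.  Hence a singleton part can only form its coalition with a part T of three
-- vertices, and every vertex x outside T is a singleton part whose only possible partner is T, so
-- G[T ∪ {x}] has a perfect matching.  Without 3-, 4- and 5-cycles this makes V ∖ T independent and
-- forces every interior vertex of a six-vertex path into T; but a cycle of length ≥ 6 contains a
-- six-vertex path, which has four interior vertices.

open import Defs hiding (sym)
open import Data.Nat using (ℕ; suc; _+_; _≤_; _<_; _∸_; z≤n; s≤s; z<s; s<s)
open import Data.Nat.Properties
  using (≤-trans; <⇒≱; ≮⇒≥; n<1+n; n≤1+n; m≤m+n; m≤n+m∸n; +-monoʳ-≤; +-monoʳ-<; +-cancelˡ-≤;
         +-cancelʳ-≤; ∸-monoˡ-≤; _<?_)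
  renaming (suc-injective to ℕ-suc-injective)
open import Data.Fin using (Fin; zero; suc; toℕ; fromℕ; inject₁; inject≤; opposite; #_)
open import Data.Fin.Properties
  using (_≟_; any?; ¬∀⟶∃¬; injective⇒≤; suc-injective; inject₁-injective; inject≤-injective;
         toℕ-injective; toℕ-inject₁; toℕ-inject≤; toℕ-fromℕ; opposite-involutive)
open import Data.Vec using (Vec; []; _∷_; lookup; tabulate; _++_)
open import Data.Vec.Membership.Propositional using (_∈_; _∉_)
import Data.Vec.Membership.DecPropositional as DecMembership
open import Data.Vec.Membership.Propositional.Properties using (∈-lookup; ∈-allFin⁺)
open import Data.Vec.Relation.Unary.Any using (here; there; index)
open import Data.Vec.Relation.Unary.Any.Properties using (lookup-index)
open import Data.Vec.Relation.Unary.All as All using (All; []; _∷_)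
open import Data.Vec.Relation.Unary.All.Properties
  using (lookup⁺; lookup⁻) renaming (tabulate⁺ to all-tabulate⁺)
open import Data.Vec.Relation.Unary.AllPairs.Core using ([]; _∷_)
open import Data.Vec.Relation.Unary.AllPairs.Properties using (++⁺)
open import Data.Vec.Relation.Unary.Linked using (Linked; []; [-]; _∷_)
open import Data.Vec.Relation.Unary.Unique.Propositional using (Unique)
open import Data.Vec.Relation.Unary.Unique.Propositional.Properties
  using (lookup-injective; tabulate⁺; map⁺)
open import Data.Product using (∃; _×_; _,_; proj₁; proj₂)
open import Data.Sum using (_⊎_; inj₁; inj₂; [_,_]′)
open import Data.Empty using (⊥; ⊥-elim)
open import Function using (_∘_; id)
open import Function.Definitions using (Injective)
open import Relation.Nullary using (¬_; Dec; yes; no)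
open import Relation.Nullary.Decidable using (_×-dec_; ¬?; decidable-stable)
open import Relation.Binary.PropositionalEquality
  using (_≡_; _≢_; refl; sym; trans; cong; subst; ≢-sym; module ≡-Reasoning)

module _ {a} {A : Set a} where

  unique⊆⇒≤ : ∀ {k m} {ys : Vec A k} {xs : Vec A m} → Unique ys → All (_∈ xs) ys → k ≤ m
  unique⊆⇒≤ {ys = ys} {xs} ys-unique ys⊆xs = injective⇒≤ position-injective
    where
    position : ∀ i → Fin _
    position i = index (lookup⁺ ys⊆xs i)

    position-injective : Injective _≡_ _≡_ position
    position-injective {i} {j} eq = lookup-injective ys-unique i j (begin
      lookup ys i             ≡⟨ lookup-index (lookup⁺ ys⊆xs i) ⟩
      lookup xs (position i)  ≡⟨ cong (lookup xs) eq ⟩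
      lookup xs (position j)  ≡⟨ lookup-index (lookup⁺ ys⊆xs j) ⟨
      lookup ys j             ∎)
      where open ≡-Reasoning

  linked-lookup : ∀ {r} {R : A → A → Set r} {k} {xs : Vec A (suc k)} →
                  Linked R xs → ∀ i → R (lookup xs (inject₁ i)) (lookup xs (suc i))
  linked-lookup {xs = _ ∷ _ ∷ _} (r ∷ _)  zero    = r
  linked-lookup                  (_ ∷ rs) (suc i) = linked-lookup rs i

module _ {n : ℕ} where

  open DecMembership (_≟_ {n}) using (_∈?_)

  ∉⇒≢ : ∀ {m} {xs : Vec (Fin n) m} {x y} → x ∉ xs → y ∈ xs → x ≢ y
  ∉⇒≢ x∉xs y∈xs refl = x∉xs y∈xs

  longer⇒∃∉ : ∀ {k m} {ys : Vec (Fin n) k} → Unique ys → (xs : Vec (Fin n) m) → m < k →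
              ∃ λ y → y ∈ ys × y ∉ xs
  longer⇒∃∉ {k} {ys = ys} ys-unique xs m<k
    with ¬∀⟶∃¬ k (λ i → lookup ys i ∈ xs) (λ i → lookup ys i ∈? xs)
                 (λ ys⊆xs → <⇒≱ m<k (unique⊆⇒≤ ys-unique (lookup⁻ ys⊆xs)))
  ... | i , y∉xs = lookup ys i , ∈-lookup i ys , y∉xs

opposite-injective : ∀ {k} → Injective _≡_ _≡_ (opposite {k})
opposite-injective {x = i} {y = j} eq =
  trans (sym (opposite-involutive i)) (trans (cong opposite eq) (opposite-involutive j))

opposite-inject₁ : ∀ {k} (i : Fin k) → opposite (inject₁ i) ≡ suc (opposite i)
opposite-inject₁ zero    = refl
opposite-inject₁ (suc i) = cong inject₁ (opposite-inject₁ i)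

inject₁²≢suc² : ∀ {k} (i : Fin k) → inject₁ (inject₁ i) ≢ suc (suc i)
inject₁²≢suc² zero    ()
inject₁²≢suc² (suc i) eq = inject₁²≢suc² i (suc-injective eq)

module _ {n : ℕ} (G : Graph n) where

  open DecMembership (_≟_ {n}) using (_∈?_)

  infix 4 _~_
  _~_ : Fin n → Fin n → Set
  _~_ = Adj G

  ~-sym : ∀ {u v} → u ~ v → v ~ u
  ~-sym = Graph.sym G

  ~⇒≢ : ∀ {u v} → u ~ v → u ≢ v
  ~⇒≢ uv refl = irrefl G uv

  record IsPath {k : ℕ} (P : Fin (suc k) → Fin n) : Set where
    field
      injective : Injective _≡_ _≡_ P
      adjacent  : ∀ i → P (inject₁ i) ~ P (suc i)

    distinct : ∀ {i j} → i ≢ j → P i ≢ P j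
    distinct i≢j = i≢j ∘ injective

  open IsPath public

  module _ {k : ℕ} {P : Fin (suc (suc k)) → Fin n} (path : IsPath P) where

    path-init : IsPath (P ∘ inject₁)
    path-init = record
      { injective = λ eq → inject₁-injective (injective path eq)
      ; adjacent  = adjacent path ∘ inject₁
      }

    path-tail : IsPath (P ∘ suc)
    path-tail = record
      { injective = λ eq → suc-injective (injective path eq)
      ; adjacent  = adjacent path ∘ suc
      }

  path-reverse : ∀ {k} {P : Fin (suc k) → Fin n} → IsPath P → IsPath (P ∘ opposite)
  path-reverse {P = P} path = record
    { injective = λ eq → opposite-injective (injective path eq)
    ; adjacent  = λ i → subst (λ j → P j ~ P (inject₁ (opposite i))) (sym (opposite-inject₁ i))
                              (~-sym (adjacent path (opposite i)))
    }

  interior-⊈ : ∀ {k m} {P : Fin (suc (suc k)) → Fin n} → IsPath P →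
               (xs : Vec (Fin n) m) → m < k → ¬ (∀ i → P (suc (inject₁ i)) ∈ xs)
  interior-⊈ path xs m<k interior⊆xs =
    <⇒≱ m<k (unique⊆⇒≤ (tabulate⁺ (λ eq → inject₁-injective (suc-injective (injective path eq))))
                        (all-tabulate⁺ interior⊆xs))

  linked-path : ∀ {k} {vs : Vec (Fin n) (suc k)} → Unique vs → Linked _~_ vs → IsPath (lookup vs)
  linked-path vs-unique vs-linked = record
    { injective = lookup-injective vs-unique _ _
    ; adjacent  = linked-lookup vs-linked
    }

  cycle-prefix-path : ∀ {L k} {c : Fin L → Fin n} → IsCycle G L c → (le : suc k ≤ L) →
                      IsPath (λ i → c (inject≤ i le))
  cycle-prefix-path (_ , c-injective , c-adjacent , _) le = record
    { injective = λ eq → inject≤-injective le le _ _ (c-injective eq)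
    ; adjacent  = λ i → c-adjacent _ _ (index-step i)
    }
    where
    index-step : ∀ i → toℕ (inject≤ (suc i) le) ≡ suc (toℕ (inject≤ (inject₁ i) le))
    index-step i = begin
      toℕ (inject≤ (suc i) le)            ≡⟨ toℕ-inject≤ (suc i) le ⟩
      suc (toℕ i)                         ≡⟨ cong suc (toℕ-inject₁ i) ⟨
      suc (toℕ (inject₁ i))               ≡⟨ cong suc (toℕ-inject≤ (inject₁ i) le) ⟨
      suc (toℕ (inject≤ (inject₁ i) le))  ∎
      where open ≡-Reasoning

  closed-path-cycle : ∀ {k} {P : Fin (3 + k) → Fin n} → IsPath P → P (fromℕ (2 + k)) ~ P zero →
                      IsCycle G (3 + k) P
  closed-path-cycle {k} {P} path closing = m≤m+n 3 k , injective path , step , close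
    where
    step : ∀ i j → toℕ j ≡ suc (toℕ i) → P i ~ P j
    step i (suc j) eq =
      subst (λ i′ → P i′ ~ P (suc j)) (toℕ-injective (trans (toℕ-inject₁ j) (ℕ-suc-injective eq)))
            (adjacent path j)

    close : ∀ i j → toℕ i ≡ 0 → suc (toℕ j) ≡ 3 + k → P j ~ P i
    close zero j _ eq =
      subst (λ j′ → P j′ ~ P zero) (toℕ-injective (trans (toℕ-fromℕ (2 + k)) (sym (ℕ-suc-injective eq))))
            closing

  neighbour-∈ : ∀ {m} {xs : Vec (Fin n) m} → (∀ {x y} → x ∉ xs → y ∉ xs → ¬ x ~ y) →
                ∀ {x y} → x ∉ xs → x ~ y → y ∈ xs
  neighbour-∈ independent x∉xs xy = decidable-stable (_ ∈? _) (λ y∉xs → independent x∉xs y∉xs xy)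

  edge-members-adjacent : ∀ {u v a b} → u ~ v → a ∈ u ∷ v ∷ [] → b ∈ u ∷ v ∷ [] → a ≢ b → a ~ b
  edge-members-adjacent uv (here refl)         (here refl)         a≢b = ⊥-elim (a≢b refl)
  edge-members-adjacent uv (here refl)         (there (here refl)) _   = uv
  edge-members-adjacent uv (there (here refl)) (here refl)         _   = ~-sym uv
  edge-members-adjacent uv (there (here refl)) (there (here refl)) a≢b = ⊥-elim (a≢b refl)

  dominating-mono : ∀ {S S′ : Fin n → Set} → (∀ v → S v → S′ v) → Dominating G S → Dominating G S′
  dominating-mono S⊆S′ dom v with dom v
  ... | inj₁ v∈S             = inj₁ (S⊆S′ v v∈S)
  ... | inj₂ (u , u∈S , vu) = inj₂ (u , S⊆S′ u u∈S , vu)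

  dominating-member : ∀ {S : Fin n → Set} → Dominating G S → Fin n → ∃ S
  dominating-member dom v with dom v
  ... | inj₁ v∈S           = v , v∈S
  ... | inj₂ (u , u∈S , _) = u , u∈S

  matching-resp : ∀ {S S′ : Fin n → Set} → (∀ v → S v → S′ v) → (∀ v → S′ v → S v) →
                  HasPerfectMatching G S → HasPerfectMatching G S′
  matching-resp S⊆S′ S′⊆S (m , matched) = m , λ v v∈S′ →
    let (mv∈S , v~mv , mmv≡v) = matched v (S′⊆S v v∈S′) in S⊆S′ _ mv∈S , v~mv , mmv≡v

  module PerfectMatching {S : Fin n → Set} (M : HasPerfectMatching G S) where

    partner : Fin n → Fin n
    partner = proj₁ M

    partner-∈ : ∀ {u} → S u → S (partner u)
    partner-∈ u∈S = proj₁ (proj₂ M _ u∈S)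

    partner-adjacent : ∀ {u} → S u → u ~ partner u
    partner-adjacent u∈S = proj₁ (proj₂ (proj₂ M _ u∈S))

    partner-involutive : ∀ {u} → S u → partner (partner u) ≡ u
    partner-involutive u∈S = proj₂ (proj₂ (proj₂ M _ u∈S))

    partner-swap : ∀ {u v} → S u → partner u ≡ v → partner v ≡ u
    partner-swap u∈S refl = partner-involutive u∈S

    partner-injective : ∀ {u v} → S u → S v → partner u ≡ partner v → u ≡ v
    partner-injective u∈S v∈S eq =
      trans (sym (partner-involutive u∈S)) (trans (cong partner eq) (partner-involutive v∈S))

  module HighGirth (girth : GirthAtLeast G 6) where

    closed-path-too-short : ∀ {k} {vs : Vec (Fin n) (3 + k)} → k < 3 → Unique vs → Linked _~_ vs →
                            lookup vs (fromℕ (2 + k)) ~ lookup vs zero → ⊥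
    closed-path-too-short k<3 vs-unique vs-linked closing =
      <⇒≱ (+-monoʳ-< 3 k<3) (girth _ _ (closed-path-cycle (linked-path vs-unique vs-linked) closing))

    no-triangle : ∀ {a b c} → a ~ b → b ~ c → c ~ a → ⊥
    no-triangle ab bc ca = closed-path-too-short z<s
      ((~⇒≢ ab ∷ ≢-sym (~⇒≢ ca) ∷ []) ∷ (~⇒≢ bc ∷ []) ∷ [] ∷ [])
      (ab ∷ bc ∷ [-]) ca

    no-square : ∀ {a b c d} → a ~ b → b ~ c → c ~ d → d ~ a → a ≢ c → b ≢ d → ⊥
    no-square ab bc cd da a≢c b≢d = closed-path-too-short (s<s z<s)
      ((~⇒≢ ab ∷ a≢c ∷ ≢-sym (~⇒≢ da) ∷ []) ∷ (~⇒≢ bc ∷ b≢d ∷ []) ∷ (~⇒≢ cd ∷ []) ∷ [] ∷ [])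
      (ab ∷ bc ∷ cd ∷ [-]) da

    no-pentagon : ∀ {a b c d e} → a ~ b → b ~ c → c ~ d → d ~ e → e ~ a →
                  a ≢ c → a ≢ d → b ≢ d → b ≢ e → c ≢ e → ⊥
    no-pentagon ab bc cd de ea a≢c a≢d b≢d b≢e c≢e = closed-path-too-short (s<s (s<s z<s))
      ((~⇒≢ ab ∷ a≢c ∷ a≢d ∷ ≢-sym (~⇒≢ ea) ∷ []) ∷ (~⇒≢ bc ∷ b≢d ∷ b≢e ∷ []) ∷
       (~⇒≢ cd ∷ c≢e ∷ []) ∷ (~⇒≢ de ∷ []) ∷ [] ∷ [])
      (ab ∷ bc ∷ cd ∷ de ∷ [-]) ea

    no-dominating-edge : ∀ {Q : Fin 5 → Fin n} → IsPath Q →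
                         ∀ {u v} → u ~ v → ¬ Dominating G (_∈ u ∷ v ∷ [])
    no-dominating-edge {Q} path {u} {v} uv dom =
      interior-⊈ path (u ∷ v ∷ []) (n<1+n 2) λ i →
        between-∈ (adjacent path (inject₁ i)) (adjacent path (suc i)) (distinct path (inject₁²≢suc² i))
      where
      outside-independent : ∀ {x y} → x ∉ u ∷ v ∷ [] → y ∉ u ∷ v ∷ [] → ¬ x ~ y
      outside-independent x∉ y∉ xy with dom _ | dom _
      ... | inj₁ x∈ | _ = x∉ x∈
      ... | _ | inj₁ y∈ = y∉ y∈
      ... | inj₂ (z , z∈ , xz) | inj₂ (z′ , z′∈ , yz′) with z ≟ z′
      ...   | yes refl = no-triangle xy yz′ (~-sym xz)
      ...   | no z≢z′  = no-square xz (edge-members-adjacent uv z∈ z′∈ z≢z′) (~-sym yz′) (~-sym xy)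
                                   (∉⇒≢ x∉ z′∈) (≢-sym (∉⇒≢ y∉ z∈))

      between-∈ : ∀ {a b c} → a ~ b → b ~ c → a ≢ c → b ∈ u ∷ v ∷ []
      between-∈ ab bc a≢c = decidable-stable (_ ∈? _) λ b∉ →
        no-triangle ab bc (edge-members-adjacent uv (neighbour-∈ outside-independent b∉ bc)
                                                    (neighbour-∈ outside-independent b∉ (~-sym ab))
                                                    (≢-sym a≢c))

    no-small-paired-dominating : ∀ {Q : Fin 5 → Fin n} → IsPath Q → ∀ {S} → PairedDominating G S →
                                 (xs : Vec (Fin n) 3) → (∀ v → S v → v ∈ xs) → ⊥
    no-small-paired-dominating {Q} path {S} (dom , M) xs S⊆xs =
      no-dominating-edge path (partner-adjacent u∈S) (dominating-mono S⊆edge dom)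
      where
      open PerfectMatching M
      u : Fin n
      u = proj₁ (dominating-member dom (Q zero))
      u∈S : S u
      u∈S = proj₂ (dominating-member dom (Q zero))

      S⊆edge : ∀ w → S w → w ∈ u ∷ partner u ∷ []
      S⊆edge w w∈S = decidable-stable (w ∈? _) λ w∉ →
        let w≢u  = w∉ ∘ here
            w≢mu = w∉ ∘ there ∘ here
            four-distinct : Unique (u ∷ partner u ∷ w ∷ partner w ∷ [])
            four-distinct =
              (~⇒≢ (partner-adjacent u∈S) ∷ ≢-sym w≢u ∷
                 (λ u≡mw → w≢mu (sym (partner-swap w∈S (sym u≡mw)))) ∷ []) ∷
              (≢-sym w≢mu ∷ (w≢u ∘ sym ∘ partner-injective u∈S w∈S) ∷ []) ∷
              (~⇒≢ (partner-adjacent w∈S) ∷ []) ∷ [] ∷ []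
        in <⇒≱ (n<1+n 3) (unique⊆⇒≤ four-distinct
             (S⊆xs _ u∈S ∷ S⊆xs _ (partner-∈ u∈S) ∷ S⊆xs _ w∈S ∷ S⊆xs _ (partner-∈ w∈S) ∷ []))

    module Triple (T : Vec (Fin n) 3) (T-unique : Unique T)
                  (completion : ∀ {x} → x ∉ T → HasPerfectMatching G (λ v → v ≡ x ⊎ v ∈ T)) where

      four-in-T : ∀ {a b c d} → Unique (a ∷ b ∷ c ∷ d ∷ []) → a ∈ T → b ∈ T → c ∈ T → d ∈ T → ⊥
      four-in-T distinct a∈ b∈ c∈ d∈ = <⇒≱ (n<1+n 3) (unique⊆⇒≤ distinct (a∈ ∷ b∈ ∷ c∈ ∷ d∈ ∷ []))

      third : ∀ t t′ → ∃ λ w → w ∈ T × w ≢ t × w ≢ t′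
      third t t′ with longer⇒∃∉ T-unique (t ∷ t′ ∷ []) (n<1+n 2)
      ... | w , w∈ , w∉ = w , w∈ , w∉ ∘ here , w∉ ∘ there ∘ here

      record Attachment (x : Fin n) : Set where
        constructor attached
        field
          anchor          : Fin n
          anchor∈T        : anchor ∈ T
          x~anchor        : x ~ anchor
          others-adjacent : ∀ {u v} → u ∈ T → v ∈ T → u ≢ anchor → v ≢ anchor → u ≢ v → u ~ v

      attachment : ∀ {x} → x ∉ T → Attachment x
      attachment {x} x∉ = attached (partner x) anchor∈ (partner-adjacent (inj₁ refl)) others-adjacent
        where
        open PerfectMatching (completion x∉)

        anchor∈ : partner x ∈ T
        anchor∈ with partner-∈ (inj₁ refl)
        ... | inj₁ mx≡x = ⊥-elim (~⇒≢ (partner-adjacent (inj₁ refl)) (sym mx≡x))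
        ... | inj₂ mx∈  = mx∈

        others-adjacent : ∀ {u v} → u ∈ T → v ∈ T → u ≢ partner x → v ≢ partner x → u ≢ v → u ~ v
        others-adjacent {u} {v} u∈ v∈ u≢a v≢a u≢v with partner-∈ (inj₂ u∈)
        ... | inj₁ mu≡x = ⊥-elim (u≢a (sym (partner-swap (inj₂ u∈) mu≡x)))
        ... | inj₂ mu∈ with partner u ≟ v
        ...   | yes refl = partner-adjacent (inj₂ u∈)
        ...   | no mu≢v  = ⊥-elim (four-in-T
          ((u≢v ∷ u≢a ∷ ~⇒≢ (partner-adjacent (inj₂ u∈)) ∷ []) ∷ (v≢a ∷ ≢-sym mu≢v ∷ []) ∷
           ((λ mx≡mu → ∉⇒≢ x∉ u∈ (partner-injective (inj₁ refl) (inj₂ u∈) mx≡mu)) ∷ []) ∷ [] ∷ [])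
          u∈ v∈ anchor∈ mu∈)

      outside-independent : ∀ {x y} → x ∉ T → y ∉ T → ¬ x ~ y
      outside-independent x∉ y∉ xy with attachment x∉ | attachment y∉
      ... | attached a a∈ xa rest-x | attached b b∈ yb rest-y with a ≟ b
      ...   | yes refl = no-triangle xy yb (~-sym xa)
      ...   | no a≢b with third a b
      ...     | w , w∈ , w≢a , w≢b =
        no-pentagon xa (rest-y a∈ w∈ a≢b w≢b (≢-sym w≢a)) (rest-x w∈ b∈ w≢a (≢-sym a≢b) w≢b)
                    (~-sym yb) (~-sym xy)
                    (∉⇒≢ x∉ w∈) (∉⇒≢ x∉ b∈) a≢b (≢-sym (∉⇒≢ y∉ a∈)) (≢-sym (∉⇒≢ y∉ w∈))

      -- The anchor of y is not z (else t ~ t′ closes a triangle through x) and not t or t′ (else the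
      -- matching edge of T ∪ {y} closes a pentagon through x), so four vertices of T would be distinct.
      neighbour-in-pair : ∀ {x t t′ y z} → x ∉ T → t ∈ T → t′ ∈ T → t ≢ t′ → t ~ x → x ~ t′ →
                          y ∉ T → y ≢ x → z ∈ T → y ~ z → z ≡ t ⊎ z ≡ t′
      neighbour-in-pair {t = t} {t′} {z = z} x∉ t∈ t′∈ t≢t′ tx xt′ y∉ y≢x z∈ yz with z ≟ t | z ≟ t′
      ... | yes z≡t | _        = inj₁ z≡t
      ... | no _    | yes z≡t′ = inj₂ z≡t′
      ... | no z≢t  | no z≢t′ with attachment y∉
      ...   | attached a a∈ ya rest with a ≟ z | a ≟ t | a ≟ t′
      ...     | yes refl | _ | _ =
        ⊥-elim (no-triangle tx xt′ (rest t′∈ t∈ (≢-sym z≢t′) (≢-sym z≢t) (≢-sym t≢t′)))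
      ...     | no _ | yes refl | _ =
        ⊥-elim (no-pentagon ya tx xt′ (rest t′∈ z∈ (≢-sym t≢t′) z≢t (≢-sym z≢t′)) (~-sym yz)
                            y≢x (∉⇒≢ y∉ t′∈) t≢t′ (≢-sym z≢t) (∉⇒≢ x∉ z∈))
      ...     | no _ | no _ | yes refl =
        ⊥-elim (no-pentagon ya (~-sym xt′) (~-sym tx) (rest t∈ z∈ t≢t′ z≢t′ (≢-sym z≢t)) (~-sym yz)
                            y≢x (∉⇒≢ y∉ t∈) (≢-sym t≢t′) (≢-sym z≢t′) (∉⇒≢ x∉ z∈))
      ...     | no a≢z | no a≢t | no a≢t′ =
        ⊥-elim (four-in-T ((a≢z ∷ a≢t ∷ a≢t′ ∷ []) ∷ (z≢t ∷ z≢t′ ∷ []) ∷ (t≢t′ ∷ []) ∷ [] ∷ [])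
                          a∈ z∈ t∈ t′∈)

      -- Q 1 would see Q 0, Q 2 ∈ T; then either Q 3, Q 4 ∈ T makes four vertices of T, or one of
      -- them is an outside vertex adjacent to a third vertex of T.
      middle-∉T-impossible : ∀ {Q : Fin 5 → Fin n} → IsPath Q → Q (# 1) ∉ T → ⊥
      middle-∉T-impossible {Q} path q₁∉ = tail-cases (Q (# 3) ∈? T) (Q (# 4) ∈? T)
        where
        q₀∈ : Q (# 0) ∈ T
        q₀∈ = neighbour-∈ outside-independent q₁∉ (~-sym (adjacent path (# 0)))

        q₂∈ : Q (# 2) ∈ T
        q₂∈ = neighbour-∈ outside-independent q₁∉ (adjacent path (# 1))

        confined : ∀ {y z} → y ∉ T → y ≢ Q (# 1) → z ∈ T → y ~ z → z ≡ Q (# 0) ⊎ z ≡ Q (# 2)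
        confined = neighbour-in-pair q₁∉ q₀∈ q₂∈ (distinct path (λ ()))
                                     (adjacent path (# 0)) (adjacent path (# 1))

        distinct-0234 : Unique (Q (# 0) ∷ Q (# 2) ∷ Q (# 3) ∷ Q (# 4) ∷ [])
        distinct-0234 = map⁺ (injective path)
          (((λ ()) ∷ (λ ()) ∷ (λ ()) ∷ []) ∷ ((λ ()) ∷ (λ ()) ∷ []) ∷ ((λ ()) ∷ []) ∷ [] ∷ [])

        tail-cases : Dec (Q (# 3) ∈ T) → Dec (Q (# 4) ∈ T) → ⊥
        tail-cases (no q₃∉) _ =
          [ distinct path (λ ()) , distinct path (λ ()) ]′
            (confined q₃∉ (distinct path (λ ()))
                      (neighbour-∈ outside-independent q₃∉ (adjacent path (# 3))) (adjacent path (# 3)))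
        tail-cases (yes q₃∈) (no q₄∉) =
          [ distinct path (λ ()) , distinct path (λ ()) ]′
            (confined q₄∉ (distinct path (λ ())) q₃∈ (~-sym (adjacent path (# 3))))
        tail-cases (yes q₃∈) (yes q₄∈) = four-in-T distinct-0234 q₀∈ q₂∈ q₃∈ q₄∈

      middle-∈T : ∀ {Q : Fin 5 → Fin n} → IsPath Q → Q (# 1) ∈ T
      middle-∈T path = decidable-stable (_ ∈? T) (middle-∉T-impossible path)

      -- Each interior vertex is the second vertex of a five-vertex subpath, read forwards or backwards.
      no-six-vertex-path : ∀ {P : Fin 6 → Fin n} → ¬ IsPath P
      no-six-vertex-path {P} path = interior-⊈ path T (n<1+n 3) interior∈T
        where
        interior∈T : ∀ i → P (suc (inject₁ i)) ∈ T
        interior∈T zero                   = middle-∈T (path-init path)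
        interior∈T (suc zero)             = middle-∈T (path-tail path)
        interior∈T (suc (suc zero))       = middle-∈T (path-tail (path-reverse path))
        interior∈T (suc (suc (suc zero))) = middle-∈T (path-init (path-reverse path))

    module Partition {P : Fin 6 → Fin n} (path : IsPath P) {k : ℕ} (p : Fin n → Fin k)
                     (partition : IsPCPartition G k p) (few-parts : n ≤ 2 + k) where

      rep : Fin k → Fin n
      rep i = proj₁ (proj₁ partition i)

      rep-part : ∀ i → p (rep i) ≡ i
      rep-part i = proj₂ (proj₁ partition i) refl

      rep-injective : Injective _≡_ _≡_ rep
      rep-injective {i} {j} eq = trans (sym (rep-part i)) (trans (cong p eq) (rep-part j))

      Extra : Fin n → Set
      Extra v = rep (p v) ≢ v

      rep-or-extra : ∀ {v i} → p v ≡ i → v ≡ rep i ⊎ Extra v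
      rep-or-extra {v} refl with rep (p v) ≟ v
      ... | yes rep≡v = inj₁ (sym rep≡v)
      ... | no v-extra = inj₂ v-extra

      extra-≢-rep : ∀ {v i} → p v ≡ i → Extra v → rep i ≢ v
      extra-≢-rep refl v-extra = v-extra

      few-extras : ∀ {m} {es : Vec (Fin n) m} → Unique es → All Extra es → m ≤ 2
      few-extras {m} {es} es-unique es-extra =
        +-cancelʳ-≤ k m 2 (≤-trans (unique⊆⇒≤ all-unique (All.universal ∈-allFin⁺ _)) few-parts)
        where
        extra-not-rep : ∀ {e} → Extra e → All (e ≢_) (tabulate rep)
        extra-not-rep e-extra = all-tabulate⁺ λ i e≡rep →
          e-extra (trans (cong (rep ∘ p) e≡rep) (trans (cong rep (rep-part i)) (sym e≡rep)))

        all-unique : Unique (es ++ tabulate rep)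
        all-unique = ++⁺ es-unique (tabulate⁺ rep-injective) (All.map extra-not-rep es-extra)

      HasExtra : Fin k → Set
      HasExtra i = ∃ λ v → p v ≡ i × Extra v

      has-extra? : ∀ i → Dec (HasExtra i)
      has-extra? i = any? λ v → (p v ≟ i) ×-dec ¬? (rep (p v) ≟ v)

      no-extra⇒rep : ∀ {i v} → ¬ HasExtra i → p v ≡ i → v ≡ rep i
      no-extra⇒rep no-extra v∈i =
        [ id , (λ v-extra → ⊥-elim (no-extra (_ , v∈i , v-extra))) ]′ (rep-or-extra v∈i)

      three≤k : 3 ≤ k
      three≤k = +-cancelˡ-≤ 2 3 k (≤-trans (n≤1+n 5) (≤-trans (injective⇒≤ (injective path)) few-parts))

      not-all-have-extras : ¬ (∀ i → HasExtra i)
      not-all-have-extras extra =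
        <⇒≱ three≤k (few-extras (tabulate⁺ extra-injective) (all-tabulate⁺ (proj₂ ∘ proj₂ ∘ extra)))
        where
        extra-injective : Injective _≡_ _≡_ (proj₁ ∘ extra)
        extra-injective {i} {j} eq =
          trans (sym (proj₁ (proj₂ (extra i)))) (trans (cong p eq) (proj₁ (proj₂ (extra j))))

      singleton-part : ∃ λ i → ∀ {v} → p v ≡ i → v ≡ rep i
      singleton-part with ¬∀⟶∃¬ k HasExtra has-extra? not-all-have-extras
      ... | i , no-extra = i , no-extra⇒rep no-extra

      small-coalition : ∀ {i j} → PairedDominating G (λ v → p v ≡ i ⊎ p v ≡ j) →
                        (xs : Vec (Fin n) 3) → (∀ {v} → p v ≡ i ⊎ p v ≡ j → v ∈ xs) → ⊥
      small-coalition pd xs covered = no-small-paired-dominating (path-init path) pd xs (λ _ → covered)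

      module TwoExtras {j e₁ e₂} (e₁∈j : p e₁ ≡ j) (e₂∈j : p e₂ ≡ j)
                       (e₁-extra : Extra e₁) (e₂-extra : Extra e₂) (e₁≢e₂ : e₁ ≢ e₂) where

        T : Vec (Fin n) 3
        T = rep j ∷ e₁ ∷ e₂ ∷ []

        T-unique : Unique T
        T-unique = (extra-≢-rep e₁∈j e₁-extra ∷ extra-≢-rep e₂∈j e₂-extra ∷ []) ∷ (e₁≢e₂ ∷ []) ∷ [] ∷ []

        T⊆j : ∀ {v} → v ∈ T → p v ≡ j
        T⊆j (here refl)                 = rep-part j
        T⊆j (there (here refl))         = e₁∈j
        T⊆j (there (there (here refl))) = e₂∈j

        extra∈T : ∀ {v} → Extra v → v ∈ T
        extra∈T {v} v-extra = decidable-stable (v ∈? T) λ v∉ →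
          <⇒≱ (n<1+n 2) (few-extras
            ((e₁≢e₂ ∷ ≢-sym (v∉ ∘ there ∘ here) ∷ []) ∷ (≢-sym (v∉ ∘ there ∘ there ∘ here) ∷ []) ∷ [] ∷ [])
            (e₁-extra ∷ e₂-extra ∷ v-extra ∷ []))

        outside-rep : ∀ {x} → x ∉ T → x ≡ rep (p x)
        outside-rep x∉ = [ id , (λ x-extra → ⊥-elim (x∉ (extra∈T x-extra))) ]′ (rep-or-extra refl)

        outside-singleton : ∀ {x v} → x ∉ T → p v ≡ p x → v ≡ x
        outside-singleton {x} x∉ v∈x with rep-or-extra v∈x
        ... | inj₁ v≡rep   = trans v≡rep (sym (outside-rep x∉))
        ... | inj₂ v-extra = ⊥-elim (x∉ (here x≡rep-j))
          where
          x≡rep-j : x ≡ rep j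
          x≡rep-j = trans (outside-rep x∉) (cong rep (trans (sym v∈x) (T⊆j (extra∈T v-extra))))

        completion : ∀ {x} → x ∉ T → HasPerfectMatching G (λ v → v ≡ x ⊎ v ∈ T)
        completion {x} x∉ with proj₂ (proj₂ partition) (p x)
        ... | j′ , _ , _ , _ , pd with j′ ≟ j
        ...   | yes refl = matching-resp (λ _ → to) (λ _ → from) (proj₂ pd)
          where
          to : ∀ {v} → p v ≡ p x ⊎ p v ≡ j → v ≡ x ⊎ v ∈ T
          to (inj₁ v∈x) = inj₁ (outside-singleton x∉ v∈x)
          to (inj₂ v∈j) = inj₂ ([ here , extra∈T ]′ (rep-or-extra v∈j))

          from : ∀ {v} → v ≡ x ⊎ v ∈ T → p v ≡ p x ⊎ p v ≡ j
          from (inj₁ refl) = inj₁ refl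
          from (inj₂ v∈T)  = inj₂ (T⊆j v∈T)
        ...   | no j′≢j = ⊥-elim (small-coalition pd (x ∷ rep j′ ∷ rep j′ ∷ []) covered)
          where
          covered : ∀ {v} → p v ≡ p x ⊎ p v ≡ j′ → v ∈ x ∷ rep j′ ∷ rep j′ ∷ []
          covered (inj₁ v∈x) = here (outside-singleton x∉ v∈x)
          covered (inj₂ v∈j′) with rep-or-extra v∈j′
          ... | inj₁ v≡rep   = there (here v≡rep)
          ... | inj₂ v-extra = ⊥-elim (j′≢j (trans (sym v∈j′) (T⊆j (extra∈T v-extra))))

        impossible : ⊥
        impossible = Triple.no-six-vertex-path T T-unique completion path

      no-pc-partition : ⊥
      no-pc-partition with singleton-part
      ... | i , singleton with proj₂ (proj₂ partition) i
      ...   | j , _ , _ , _ , pd with has-extra? j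
      ...     | no no-extra = small-coalition pd (rep i ∷ rep j ∷ rep j ∷ []) covered
        where
        covered : ∀ {v} → p v ≡ i ⊎ p v ≡ j → v ∈ rep i ∷ rep j ∷ rep j ∷ []
        covered (inj₁ v∈i) = here (singleton v∈i)
        covered (inj₂ v∈j) = there (here (no-extra⇒rep no-extra v∈j))
      ...     | yes (e₁ , e₁∈j , e₁-extra)
        with any? (λ v → (p v ≟ j) ×-dec (¬? (rep (p v) ≟ v) ×-dec ¬? (v ≟ e₁)))
      ...       | yes (e₂ , e₂∈j , e₂-extra , e₂≢e₁) =
        TwoExtras.impossible e₁∈j e₂∈j e₁-extra e₂-extra (≢-sym e₂≢e₁)
      ...       | no no-second = small-coalition pd (rep i ∷ rep j ∷ e₁ ∷ []) covered
        where
        covered : ∀ {v} → p v ≡ i ⊎ p v ≡ j → v ∈ rep i ∷ rep j ∷ e₁ ∷ []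
        covered (inj₁ v∈i) = here (singleton v∈i)
        covered {v} (inj₂ v∈j) with rep-or-extra v∈j | v ≟ e₁
        ... | inj₁ v≡rep   | _        = there (here v≡rep)
        ... | inj₂ _       | yes v≡e₁ = there (there (here v≡e₁))
        ... | inj₂ v-extra | no v≢e₁  = ⊥-elim (no-second (v , v∈j , v-extra , v≢e₁))

mainTheorem16 : (n : ℕ) (G : Graph n) → HasCycle G → GirthAtLeast G 6 → (pc : ℕ) → IsPC G pc → pc < n ∸ 2
mainTheorem16 n G (L , c , cycle) girth pc = pc<n∸2
  where
  path : IsPath G (λ i → c (inject≤ i (girth L c cycle)))
  path = cycle-prefix-path G cycle (girth L c cycle)

  pc<n∸2 : IsPC G pc → pc < n ∸ 2
  pc<n∸2 (inj₁ (refl , _)) = ≤-trans (s≤s z≤n) (∸-monoˡ-≤ 2 (injective⇒≤ (injective path)))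
  pc<n∸2 (inj₂ ((p , partition) , _)) = decidable-stable (pc <? n ∸ 2) λ pc≮n∸2 →
    HighGirth.Partition.no-pc-partition G girth path p partition
      (≤-trans (m≤n+m∸n n 2) (+-monoʳ-≤ 2 (≮⇒≥ pc≮n∸2)))
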